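{- Let $n\ge4$ be an integer, $\mathrm{TH}_m=\binom{m+2}{3}$, and $\mathcal{TH}_n=\langle \mathrm{TH}_n,\mathrm{TH}_{n+1},\mathrm{TH}_{n+2},\mathrm{TH}_{n+3}\rangle$. A minimal presentation of $\mathcal{TH}_n$ is ($k$ a non-negative integer): (1) if $n=6k$: $\left\{ \big(\tfrac{n+2}{2}x_4,2x_3+\tfrac{n+4}{2}x_2\big), \big((n+1)x_3,(n+4)x_2\big), \big(\tfrac{n}{3}x_2,\tfrac{n+3}{3}x_1\big) \right\}$; (2) if $n=6k+1$: $\left\{ \big(\tfrac{n+2}{3}x_4,\tfrac{n+5}{3}x_3\big), \big(\tfrac{n+1}{2}x_3,2x_2+\tfrac{n+3}{2}x_1\big), \big(nx_2,(n+3)x_1\big) \right\}$; (3) if $n=6k+2$: $\left\{ \big(\tfrac{n+2}{2}x_4,2x_3+\tfrac{n+4}{2}x_2\big), \big(\tfrac{n+1}{3}x_3,\tfrac{n+4}{3}x_2\big), \big(nx_2,(n+3)x_1\big) \right\}$; (4) if $n=6k+3$: $\left\{ \big((n+2)x_4,(n+5)x_3\big), \big(\tfrac{n+1}{2}x_3,2x_2+\tfrac{n+3}{2}x_1\big), \big(\tfrac{n}{3}x_2,\tfrac{n+3}{3}x_1\big) \right\}$; (5) if $n=6k+4$: $\left\{ \big((n+3)x_1,nx_2\big), \big(\tfrac{n+4}{2}x_2,\tfrac{n-1}{3}x_3+\tfrac{n+2}{6}x_4\big), \big(\tfrac{n+5}{3}x_3,\tfrac{n+2}{3}x_4\big) \right\}$;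 (6) if $n=6k+5$: $\left\{ \big(\tfrac{n+3}{2}x_1,\tfrac{n-2}{3}x_2+\tfrac{n+1}{6}x_3\big), \big(\tfrac{n+4}{3}x_2,\tfrac{n+1}{3}x_3\big), \big((n+5)x_3,(n+2)x_4\big) \right\}$.
   Context: For $n\ge4$, $\{\mathrm{TH}_n,\ldots,\mathrm{TH}_{n+3}\}$ is the minimal system of generators of $\mathcal{TH}_n$. Let $\varphi:\mathbb N^4\to\mathcal{TH}_n$, $\varphi(u_1,u_2,u_3,u_4)=\sum_{i=1}^4 u_i\,\mathrm{TH}_{n+i-1}$, and let $\sim$ be its kernel congruence on $\mathbb N^4$ ($u\sim v$ iff $\varphi(u)=\varphi(v)$). Here $x_1,\ldots,x_4$ are the standard unit vectors of $\mathbb N^4$ (so $x_i$ corresponds to the generator $\mathrm{TH}_{n+i-1}$), and linear combinations of them denote elements of $\mathbb N^4$. For $\rho\subseteq \mathbb N^4\times\mathbb N^4$, the congruence generated by $\rho$ is the intersection of all congruences on $\mathbb N^4$ containing $\rho$. A presentation of $\mathcal{TH}_n$ is a set $\rho$ generating $\sim$, and a minimal presentation is a presentation no proper subset of which is a presentation. -}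

module Defs where

open import Level using (0ℓ; Lift) renaming (suc to lsuc)
open import Data.Nat using (ℕ; zero; suc; _+_; _*_; _∸_)
open import Data.Nat.DivMod using (_/_)
open import Data.Nat.Combinatorics using (_C_)
open import Data.Vec using (Vec; []; _∷_; zipWith; map)
open import Data.Product using (_×_; _,_; ∃-syntax)
open import Data.List using (List; []; _∷_)
open import Data.List.Membership.Propositional using (_∈_)
open import Relation.Binary.Core using (Rel)
open import Relation.Binary.Structures using (IsEquivalence)
open import Relation.Binary.PropositionalEquality using (_≡_)
open import Relation.Unary using (Pred; _⊆_; _∉_)
open import Relation.Nullary using (¬_)
open import Function.Bundles using (_⇔_)

TH : ℕ → ℕ
TH m = (m + 2) C 3

ℕ⁴ : Set
ℕ⁴ = Vec ℕ 4

_⊕_ : ℕ⁴ → ℕ⁴ → ℕ⁴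
_⊕_ = zipWith _+_
infixl 6 _⊕_

_·_ : ℕ → ℕ⁴ → ℕ⁴
c · u = map (c *_) u
infixl 7 _·_

x₁ x₂ x₃ x₄ : ℕ⁴
x₁ = 1 ∷ 0 ∷ 0 ∷ 0 ∷ []
x₂ = 0 ∷ 1 ∷ 0 ∷ 0 ∷ []
x₃ = 0 ∷ 0 ∷ 1 ∷ 0 ∷ []
x₄ = 0 ∷ 0 ∷ 0 ∷ 1 ∷ []

φ : ℕ → ℕ⁴ → ℕ
φ n (u₁ ∷ u₂ ∷ u₃ ∷ u₄ ∷ []) =
  u₁ * TH n + u₂ * TH (n + 1) + u₃ * TH (n + 2) + u₄ * TH (n + 3)

_∼[_]_ : ℕ⁴ → ℕ → ℕ⁴ → Set
u ∼[ n ] v = φ n u ≡ φ n v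

record IsCongruence (R : Rel ℕ⁴ 0ℓ) : Set where
  field
    isEquivalence : IsEquivalence R
    compatible    : ∀ {u v w} → R u v → R (u ⊕ w) (v ⊕ w)

PairSet : Set₁
PairSet = Pred (ℕ⁴ × ℕ⁴) 0ℓ

Generated : PairSet → ℕ⁴ → ℕ⁴ → Set₁
Generated ρ u v =
  (R : Rel ℕ⁴ 0ℓ) → IsCongruence R → (∀ {a b} → ρ (a , b) → R a b) → R u v

IsPresentation : ℕ → PairSet → Set₁
IsPresentation n ρ = ∀ u v → (Generated ρ u v ⇔ Lift (lsuc 0ℓ) (u ∼[ n ] v))

IsMinimalPresentation : ℕ → PairSet → Set₁
IsMinimalPresentation n ρ =
  IsPresentation n ρ ×
  ((σ : PairSet) → σ ⊆ ρ → (∃[ p ] (ρ p × p ∉ σ)) → ¬ IsPresentation n σ)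

setOf : List (ℕ⁴ × ℕ⁴) → PairSet
setOf l p = p ∈ l

ρ₀ ρ₁ ρ₂ ρ₃ ρ₄ ρ₅ : ℕ → PairSet
ρ₀ n = setOf
  ( ((n + 2) / 2 · x₄ , 2 · x₃ ⊕ (n + 4) / 2 · x₂)
  ∷ ((n + 1) · x₃ , (n + 4) · x₂)
  ∷ (n / 3 · x₂ , (n + 3) / 3 · x₁)
  ∷ [])
ρ₁ n = setOf
  ( ((n + 2) / 3 · x₄ , (n + 5) / 3 · x₃)
  ∷ ((n + 1) / 2 · x₃ , 2 · x₂ ⊕ (n + 3) / 2 · x₁)
  ∷ (n · x₂ , (n + 3) · x₁)
  ∷ [])
ρ₂ n = setOf
  ( ((n + 2) / 2 · x₄ , 2 · x₃ ⊕ (n + 4) / 2 · x₂)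
  ∷ ((n + 1) / 3 · x₃ , (n + 4) / 3 · x₂)
  ∷ (n · x₂ , (n + 3) · x₁)
  ∷ [])
ρ₃ n = setOf
  ( ((n + 2) · x₄ , (n + 5) · x₃)
  ∷ ((n + 1) / 2 · x₃ , 2 · x₂ ⊕ (n + 3) / 2 · x₁)
  ∷ (n / 3 · x₂ , (n + 3) / 3 · x₁)
  ∷ [])
ρ₄ n = setOf
  ( ((n + 3) · x₁ , n · x₂)
  ∷ ((n + 4) / 2 · x₂ , (n ∸ 1) / 3 · x₃ ⊕ (n + 2) / 6 · x₄)
  ∷ ((n + 5) / 3 · x₃ , (n + 2) / 3 · x₄)
  ∷ [])
ρ₅ n = setOf
  ( ((n + 3) / 2 · x₁ , (n ∸ 2) / 3 · x₂ ⊕ (n + 1) / 6 · x₃)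
  ∷ ((n + 4) / 3 · x₂ , (n + 1) / 3 · x₃)
  ∷ ((n + 5) · x₃ , (n + 2) · x₄)
  ∷ [])

{-# OPTIONS --safe #-}

-- Each of the six sets is triangular: in a suitable order a, b, c, d of the generators
-- (descending from x₄ when n ≡ 0, 1, 2, 3 and ascending from x₁ when n ≡ 4, 5 modulo 6)
-- it reads
--   A·a ~ α·b + β·c,   B·b ~ γ·c + δ·d,   C·c ~ D·d.
-- Rewriting with these relations brings every element of ℕ⁴ to a normal form with a < A,
-- b < B and c < C.  Distinct normal forms have distinct images, because a, then b, then c
-- can be read off the image modulo A, B, C after multiplying by a suitable factor; so the
-- relations generate the kernel congruence.  None of them can be dropped: the additive
-- functionals with weights (1, 0, 0, 0), (α, A, 0, 0) and (αγ + βB, γA, AB, 0) each respect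
-- exactly two of the three relations.

module Submission where

open import Defs
open import Level using (0ℓ; lift; lower)
open import Data.Nat using (ℕ; zero; suc; _+_; _*_; _∸_; _<_; _≤_; NonZero; ≢-nonZero⁻¹; z≤n; s≤s)
open import Data.Nat.Properties
  using (+-comm; +-assoc; +-identityʳ; *-identityʳ; *-zeroʳ; *-assoc; *-distribˡ-+;
         +-cancelˡ-≡; *-cancelˡ-≡; *-cancelʳ-≡; *-monoʳ-<; m*n≢0; +-∸-assoc)
open import Data.Nat.DivMod
  using (_/_; _%_; m≡m%n+[m/n]*n; [m+kn]%n≡m%n; m<n⇒m%n≡m; m%n<n; m*n/n≡m)
open import Data.Nat.Divisibility using (_∣_; divides; ∣m∣n⇒∣m+n; ∣n⇒∣m*n)
open import Data.Nat.Combinatorics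
  using (nCk+nC[k+1]≡[n+1]C[k+1]; nC1≡n) renaming (_C_ to _choose_)
open import Data.Nat.Tactic.RingSolver using (solve; solve-∀)
open import Data.Vec using ([]; _∷_)
open import Data.List using (List; []; _∷_; [_])
open import Data.List.Relation.Unary.All using (All; []; _∷_)
open import Data.List.Relation.Unary.Any using (here; there)
open import Data.Product using (_×_; _,_; proj₁; proj₂; ∃-syntax)
open import Data.Sum using (_⊎_; inj₁; inj₂)
open import Data.Empty using (⊥-elim)
open import Relation.Binary.Core using (Rel)
open import Relation.Binary.Structures using (IsEquivalence)
open import Relation.Binary.PropositionalEquality
  using (_≡_; _≢_; refl; sym; trans; cong; cong₂; subst; subst₂; module ≡-Reasoning)
open import Relation.Nullary using (¬_)
open import Relation.Unary using (_⊆_; _∉_)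
open import Function.Bundles using (_⇔_; mk⇔; Equivalence)
open ≡-Reasoning

2*[1+n]C2≡[1+n]*n : ∀ n → 2 * (suc n choose 2) ≡ suc n * n
2*[1+n]C2≡[1+n]*n zero    = refl
2*[1+n]C2≡[1+n]*n (suc n) = begin
  2 * (suc (suc n) choose 2)             ≡⟨ cong (2 *_) (nCk+nC[k+1]≡[n+1]C[k+1] (suc n) 1) ⟨
  2 * (suc n choose 1 + suc n choose 2)  ≡⟨ cong (λ m → 2 * (m + suc n choose 2)) (nC1≡n (suc n)) ⟩
  2 * (suc n + suc n choose 2)           ≡⟨ *-distribˡ-+ 2 (suc n) (suc n choose 2) ⟩
  2 * suc n + 2 * (suc n choose 2)       ≡⟨ cong (2 * suc n +_) (2*[1+n]C2≡[1+n]*n n) ⟩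
  2 * suc n + suc n * n                  ≡⟨ solve [ n ] ⟩
  suc (suc n) * suc n                    ∎

6*[2+m]C3≡m*[1+m]*[2+m] : ∀ m → 6 * (suc (suc m) choose 3) ≡ m * suc m * suc (suc m)
6*[2+m]C3≡m*[1+m]*[2+m] zero    = refl
6*[2+m]C3≡m*[1+m]*[2+m] (suc m) = begin
  6 * (suc (suc (suc m)) choose 3)
    ≡⟨ cong (6 *_) (nCk+nC[k+1]≡[n+1]C[k+1] (suc (suc m)) 2) ⟨
  6 * (suc (suc m) choose 2 + suc (suc m) choose 3)
    ≡⟨ *-distribˡ-+ 6 (suc (suc m) choose 2) (suc (suc m) choose 3) ⟩
  6 * (suc (suc m) choose 2) + 6 * (suc (suc m) choose 3)
    ≡⟨ cong₂ _+_ (*-assoc 3 2 (suc (suc m) choose 2)) (6*[2+m]C3≡m*[1+m]*[2+m] m) ⟩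
  3 * (2 * (suc (suc m) choose 2)) + m * suc m * suc (suc m)
    ≡⟨ cong (λ x → 3 * x + m * suc m * suc (suc m)) (2*[1+n]C2≡[1+n]*n (suc m)) ⟩
  3 * (suc (suc m) * suc m) + m * suc m * suc (suc m)
    ≡⟨ solve [ m ] ⟩
  suc m * suc (suc m) * suc (suc (suc m))
    ∎

6*TH≡m*[1+m]*[2+m] : ∀ m → 6 * TH m ≡ m * (1 + m) * (2 + m)
6*TH≡m*[1+m]*[2+m] m =
  trans (cong (λ k → 6 * (k choose 3)) (+-comm m 2)) (6*[2+m]C3≡m*[1+m]*[2+m] m)

TH-closed-form : ∀ m {p} → m * (1 + m) * (2 + m) ≡ 6 * p → TH m ≡ p
TH-closed-form m {p} eq = *-cancelˡ-≡ (TH m) p 6 (trans (6*TH≡m*[1+m]*[2+m] m) eq)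

Additive : (ℕ⁴ → ℕ) → Set
Additive f = ∀ u v → f (u ⊕ v) ≡ f u + f v

kernel-isCongruence : ∀ {f} → Additive f → IsCongruence (λ u v → f u ≡ f v)
kernel-isCongruence {f} additive = record
  { isEquivalence = record { refl = refl ; sym = sym ; trans = trans }
  ; compatible    = λ {u} {v} {w} fu≡fv → begin
      f (u ⊕ w)  ≡⟨ additive u w ⟩
      f u + f w  ≡⟨ cong (_+ f w) fu≡fv ⟩
      f v + f w  ≡⟨ additive v w ⟨
      f (v ⊕ w)  ∎
  }

generated⊆kernel : ∀ {f ρ u v} → Additive f → (∀ {a b} → ρ (a , b) → f a ≡ f b) →
                   Generated ρ u v → f u ≡ f v
generated⊆kernel additive ρ⊆kernel gen = gen _ (kernel-isCongruence additive) ρ⊆kernel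

dot : ℕ⁴ → ℕ⁴ → ℕ
dot (u₁ ∷ u₂ ∷ u₃ ∷ u₄ ∷ []) (w₁ ∷ w₂ ∷ w₃ ∷ w₄ ∷ []) = u₁ * w₁ + u₂ * w₂ + u₃ * w₃ + u₄ * w₄

dot-additive : ∀ w → Additive (λ u → dot u w)
dot-additive (w₁ ∷ w₂ ∷ w₃ ∷ w₄ ∷ []) (u₁ ∷ u₂ ∷ u₃ ∷ u₄ ∷ []) (v₁ ∷ v₂ ∷ v₃ ∷ v₄ ∷ []) =
  distrib u₁ u₂ u₃ u₄ v₁ v₂ v₃ v₄ w₁ w₂ w₃ w₄
  where
  distrib : ∀ u₁ u₂ u₃ u₄ v₁ v₂ v₃ v₄ w₁ w₂ w₃ w₄ →
    (u₁ + v₁) * w₁ + (u₂ + v₂) * w₂ + (u₃ + v₃) * w₃ + (u₄ + v₄) * w₄ ≡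
    (u₁ * w₁ + u₂ * w₂ + u₃ * w₃ + u₄ * w₄) + (v₁ * w₁ + v₂ * w₂ + v₃ * w₃ + v₄ * w₄)
  distrib = solve-∀

TH-weights : ℕ → ℕ⁴
TH-weights n = TH n ∷ TH (n + 1) ∷ TH (n + 2) ∷ TH (n + 3) ∷ []

φ≡dot : ∀ n u → φ n u ≡ dot u (TH-weights n)
φ≡dot n (_ ∷ _ ∷ _ ∷ _ ∷ []) = refl

φ-additive : ∀ n → Additive (φ n)
φ-additive n u v = begin
  φ n (u ⊕ v)        ≡⟨ φ≡dot n (u ⊕ v) ⟩
  dot (u ⊕ v) W      ≡⟨ dot-additive W u v ⟩
  dot u W + dot v W  ≡⟨ cong₂ _+_ (φ≡dot n u) (φ≡dot n v) ⟨
  φ n u + φ n v      ∎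
  where
  W : ℕ⁴
  W = TH-weights n

-- Minimality through separating functionals

record Separator (ρ : PairSet) (p : ℕ⁴ × ℕ⁴) : Set where
  field
    functional      : ℕ⁴ → ℕ
    additive        : Additive functional
    separates       : functional (proj₁ p) ≢ functional (proj₂ p)
    respects-others : ∀ {q} → ρ q → q ≡ p ⊎ functional (proj₁ q) ≡ functional (proj₂ q)

minimal-if-separated : ∀ {n ρ} → IsPresentation n ρ → (∀ {p} → ρ p → Separator ρ p) →
                       IsMinimalPresentation n ρ
minimal-if-separated {n} {ρ} presents separator = presents , no-proper-subpresentation
  where
  no-proper-subpresentation : (σ : PairSet) → σ ⊆ ρ → ∃[ p ] (ρ p × p ∉ σ) → ¬ IsPresentation n σ
  no-proper-subpresentation σ σ⊆ρ ((x , y) , ρxy , xy∉σ) σ-presents =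
    separates (generated⊆kernel additive σ⊆kernel σ-generates-xy)
    where
    open Separator (separator ρxy)
    σ-generates-xy : Generated σ x y
    σ-generates-xy =
      Equivalence.from (σ-presents x y) (Equivalence.to (presents x y) (λ _ _ ρ⊆R → ρ⊆R ρxy))
    σ⊆kernel : ∀ {a b} → σ (a , b) → functional a ≡ functional b
    σ⊆kernel σab with respects-others (σ⊆ρ σab)
    ... | inj₁ refl      = ⊥-elim (xy∉σ σab)
    ... | inj₂ respected = respected

data Order : Set where
  ascending descending : Order

vec : Order → ℕ → ℕ → ℕ → ℕ → ℕ⁴
vec ascending  a b c d = a ∷ b ∷ c ∷ d ∷ []
vec descending a b c d = d ∷ c ∷ b ∷ a ∷ []

e₁ e₂ e₃ e₄ : Order → ℕ⁴
e₁ o = vec o 1 0 0 0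
e₂ o = vec o 0 1 0 0
e₃ o = vec o 0 0 1 0
e₄ o = vec o 0 0 0 1

data Coordinates (o : Order) : ℕ⁴ → Set where
  coordinates : ∀ a b c d → Coordinates o (vec o a b c d)

coordinatesOf : ∀ o u → Coordinates o u
coordinatesOf ascending  (a ∷ b ∷ c ∷ d ∷ []) = coordinates a b c d
coordinatesOf descending (d ∷ c ∷ b ∷ a ∷ []) = coordinates a b c d

vec-cong : ∀ o {a b c d a' b' c' d'} → a ≡ a' → b ≡ b' → c ≡ c' → d ≡ d' →
           vec o a b c d ≡ vec o a' b' c' d'
vec-cong o refl refl refl refl = refl

·-vec : ∀ o k a b c d → k · vec o a b c d ≡ vec o (k * a) (k * b) (k * c) (k * d)
·-vec ascending  _ _ _ _ _ = refl
·-vec descending _ _ _ _ _ = refl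

vec-⊕ : ∀ o a b c d a' b' c' d' →
        vec o a b c d ⊕ vec o a' b' c' d' ≡ vec o (a + a') (b + b') (c + c') (d + d')
vec-⊕ ascending  _ _ _ _ _ _ _ _ = refl
vec-⊕ descending _ _ _ _ _ _ _ _ = refl

vec-⊕-·vec : ∀ o a b c d k a' b' c' d' →
             vec o a b c d ⊕ k · vec o a' b' c' d' ≡
             vec o (a + k * a') (b + k * b') (c + k * c') (d + k * d')
vec-⊕-·vec ascending  _ _ _ _ _ _ _ _ _ = refl
vec-⊕-·vec descending _ _ _ _ _ _ _ _ _ = refl

·-e₁ : ∀ o k → k · e₁ o ≡ vec o k 0 0 0
·-e₁ o k = trans (·-vec o k 1 0 0 0) (vec-cong o (*-identityʳ k) (*-zeroʳ k) (*-zeroʳ k) (*-zeroʳ k))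

·-e₂ : ∀ o k → k · e₂ o ≡ vec o 0 k 0 0
·-e₂ o k = trans (·-vec o k 0 1 0 0) (vec-cong o (*-zeroʳ k) (*-identityʳ k) (*-zeroʳ k) (*-zeroʳ k))

·-e₃ : ∀ o k → k · e₃ o ≡ vec o 0 0 k 0
·-e₃ o k = trans (·-vec o k 0 0 1 0) (vec-cong o (*-zeroʳ k) (*-zeroʳ k) (*-identityʳ k) (*-zeroʳ k))

·-e₄ : ∀ o k → k · e₄ o ≡ vec o 0 0 0 k
·-e₄ o k = trans (·-vec o k 0 0 0 1) (vec-cong o (*-zeroʳ k) (*-zeroʳ k) (*-zeroʳ k) (*-identityʳ k))

·-e₂⊕·-e₃ : ∀ o p q → p · e₂ o ⊕ q · e₃ o ≡ vec o 0 p q 0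
·-e₂⊕·-e₃ o p q = trans (cong₂ _⊕_ (·-e₂ o p) (·-e₃ o q))
  (trans (vec-⊕ o 0 p 0 0 0 0 q 0) (vec-cong o refl (+-identityʳ p) refl refl))

·-e₃⊕·-e₄ : ∀ o p q → p · e₃ o ⊕ q · e₄ o ≡ vec o 0 0 p q
·-e₃⊕·-e₄ o p q = trans (cong₂ _⊕_ (·-e₃ o p) (·-e₄ o q))
  (trans (vec-⊕ o 0 0 p 0 0 0 0 q) (vec-cong o refl refl (+-identityʳ p) refl))

combination : List ℕ → List ℕ → ℕ
combination (c ∷ cs) (w ∷ ws) = c * w + combination cs ws
combination _        _        = 0

dot-vec : ∀ o a b c d w x y z →
          dot (vec o a b c d) (vec o w x y z) ≡ combination (a ∷ b ∷ c ∷ d ∷ []) (w ∷ x ∷ y ∷ z ∷ [])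
dot-vec ascending  a b c d w x y z = regroup a b c d w x y z
  where
  regroup : ∀ a b c d w x y z → a * w + b * x + c * y + d * z ≡ a * w + (b * x + (c * y + (d * z + 0)))
  regroup = solve-∀
dot-vec descending a b c d w x y z = reverse a b c d w x y z
  where
  reverse : ∀ a b c d w x y z → d * z + c * y + b * x + a * w ≡ a * w + (b * x + (c * y + (d * z + 0)))
  reverse = solve-∀

-- Rewriting with a congruence

⊕-comm : ∀ u v → u ⊕ v ≡ v ⊕ u
⊕-comm (u₁ ∷ u₂ ∷ u₃ ∷ u₄ ∷ []) (v₁ ∷ v₂ ∷ v₃ ∷ v₄ ∷ []) =
  vec-cong ascending (+-comm u₁ v₁) (+-comm u₂ v₂) (+-comm u₃ v₃) (+-comm u₄ v₄)

⊕-0· : ∀ w p → w ⊕ 0 · p ≡ w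
⊕-0· (w₁ ∷ w₂ ∷ w₃ ∷ w₄ ∷ []) (_ ∷ _ ∷ _ ∷ _ ∷ []) =
  vec-cong ascending (+-identityʳ w₁) (+-identityʳ w₂) (+-identityʳ w₃) (+-identityʳ w₄)

⊕-suc· : ∀ w k p → w ⊕ suc k · p ≡ (w ⊕ p) ⊕ k · p
⊕-suc· (w₁ ∷ w₂ ∷ w₃ ∷ w₄ ∷ []) k (p₁ ∷ p₂ ∷ p₃ ∷ p₄ ∷ []) = vec-cong ascending
  (sym (+-assoc w₁ p₁ (k * p₁))) (sym (+-assoc w₂ p₂ (k * p₂)))
  (sym (+-assoc w₃ p₃ (k * p₃))) (sym (+-assoc w₄ p₄ (k * p₄)))

m+n*0≡m : ∀ m n → m + n * 0 ≡ m
m+n*0≡m m n = trans (cong (m +_) (*-zeroʳ n)) (+-identityʳ m)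

module Rewriting {R : Rel ℕ⁴ 0ℓ} (R-congruence : IsCongruence R) where
  open IsCongruence R-congruence
  open IsEquivalence isEquivalence using () renaming (refl to R-refl; trans to R-trans)

  compatibleˡ : ∀ {u v} w → R u v → R (w ⊕ u) (w ⊕ v)
  compatibleˡ {u} {v} w r = subst₂ R (⊕-comm u w) (⊕-comm v w) (compatible r)

  repeat : ∀ {p q} → R p q → ∀ k w → R (w ⊕ k · p) (w ⊕ k · q)
  repeat {p} {q} r zero    w = subst₂ R (sym (⊕-0· w p)) (sym (⊕-0· w q)) R-refl
  repeat {p} {q} r (suc k) w = subst₂ R (sym (⊕-suc· w k p)) (sym (⊕-suc· w k q))
    (R-trans (repeat r k (w ⊕ p)) (compatible (compatibleˡ w r)))

  module _ (o : Order) where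

    reduce-first : ∀ {A α β} .{{_ : NonZero A}} → R (vec o A 0 0 0) (vec o 0 α β 0) →
                   ∀ a b c d → R (vec o a b c d) (vec o (a % A) (a / A * α + b) (a / A * β + c) d)
    reduce-first {A} {α} {β} r a b c d = subst₂ R
      (trans (vec-⊕-·vec o (a % A) b c d q A 0 0 0)
             (vec-cong o (sym (m≡m%n+[m/n]*n a A)) (m+n*0≡m b q) (m+n*0≡m c q) (m+n*0≡m d q)))
      (trans (vec-⊕-·vec o (a % A) b c d q 0 α β 0)
             (vec-cong o (m+n*0≡m (a % A) q) (+-comm b (q * α)) (+-comm c (q * β)) (m+n*0≡m d q)))
      (repeat r q (vec o (a % A) b c d))
      where
      q : ℕ
      q = a / A

    reduce-second : ∀ {B γ δ} .{{_ : NonZero B}} → R (vec o 0 B 0 0) (vec o 0 0 γ δ) →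
                    ∀ a b c d → R (vec o a b c d) (vec o a (b % B) (b / B * γ + c) (b / B * δ + d))
    reduce-second {B} {γ} {δ} r a b c d = subst₂ R
      (trans (vec-⊕-·vec o a (b % B) c d q 0 B 0 0)
             (vec-cong o (m+n*0≡m a q) (sym (m≡m%n+[m/n]*n b B)) (m+n*0≡m c q) (m+n*0≡m d q)))
      (trans (vec-⊕-·vec o a (b % B) c d q 0 0 γ δ)
             (vec-cong o (m+n*0≡m a q) (m+n*0≡m (b % B) q) (+-comm c (q * γ)) (+-comm d (q * δ))))
      (repeat r q (vec o a (b % B) c d))
      where
      q : ℕ
      q = b / B

    reduce-third : ∀ {C D} .{{_ : NonZero C}} → R (vec o 0 0 C 0) (vec o 0 0 0 D) →
                   ∀ a b c d → R (vec o a b c d) (vec o a b (c % C) (c / C * D + d))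
    reduce-third {C} {D} r a b c d = subst₂ R
      (trans (vec-⊕-·vec o a b (c % C) d q 0 0 C 0)
             (vec-cong o (m+n*0≡m a q) (m+n*0≡m b q) (sym (m≡m%n+[m/n]*n c C)) (m+n*0≡m d q)))
      (trans (vec-⊕-·vec o a b (c % C) d q 0 0 0 D)
             (vec-cong o (m+n*0≡m a q) (m+n*0≡m b q) (m+n*0≡m (c % C) q) (+-comm d (q * D))))
      (repeat r q (vec o a b (c % C) d))
      where
      q : ℕ
      q = c / C

-- Multiplying by scale sends G to unit and every weight of rest to 0 modulo unit · M, so the
-- value of a · G + combination cs rest determines a when a < M.
record Isolation (M G : ℕ) (rest : List ℕ) : Set where
  field
    scale unit quotient : ℕ
    {{unit≢0}}  : NonZero unit
    leading     : scale * G ≡ unit + quotient * (unit * M)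
    annihilates : All (λ H → unit * M ∣ scale * H) rest

∣-combination : ∀ {m} s {ws} → All (λ w → m ∣ s * w) ws → ∀ cs → m ∣ s * combination cs ws
∣-combination s _  []       = divides 0 (*-zeroʳ s)
∣-combination s [] (_ ∷ _)  = divides 0 (*-zeroʳ s)
∣-combination {m} s {w ∷ ws} (m∣sw ∷ m∣sws) (c ∷ cs) =
  subst (m ∣_) (sym (*-distribˡ-+ s (c * w) (combination cs ws)))
    (∣m∣n⇒∣m+n (subst (m ∣_) (rearrange s c w) (∣n⇒∣m*n c m∣sw)) (∣-combination s m∣sws cs))
  where
  rearrange : ∀ s c w → c * (s * w) ≡ s * (c * w)
  rearrange = solve-∀

module _ {M G rest} .{{_ : NonZero M}} (I : Isolation M G rest) where
  open Isolation I

  private instance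
    unit*M≢0 : NonZero (unit * M)
    unit*M≢0 = m*n≢0 unit M

  residue : ∀ {a} cs → a < M → (scale * (a * G + combination cs rest)) % (unit * M) ≡ unit * a
  residue {a} cs a<M with ∣-combination scale annihilates cs
  ... | divides t scale*T≡t*[unit*M] = begin
    (scale * (a * G + T)) % (unit * M)
      ≡⟨ cong (_% (unit * M)) expand ⟩
    (unit * a + (a * quotient + t) * (unit * M)) % (unit * M)
      ≡⟨ [m+kn]%n≡m%n (unit * a) (a * quotient + t) (unit * M) ⟩
    (unit * a) % (unit * M)
      ≡⟨ m<n⇒m%n≡m (*-monoʳ-< unit a<M) ⟩
    unit * a
      ∎
    where
    T : ℕ
    T = combination cs rest
    distribute : ∀ s a G T → s * (a * G + T) ≡ a * (s * G) + s * T
    distribute = solve-∀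
    collect : ∀ a u q M t → a * (u + q * (u * M)) + t * (u * M) ≡ u * a + (a * q + t) * (u * M)
    collect = solve-∀
    expand : scale * (a * G + T) ≡ unit * a + (a * quotient + t) * (unit * M)
    expand = begin
      scale * (a * G + T)
        ≡⟨ distribute scale a G T ⟩
      a * (scale * G) + scale * T
        ≡⟨ cong₂ (λ x y → a * x + y) leading scale*T≡t*[unit*M] ⟩
      a * (unit + quotient * (unit * M)) + t * (unit * M)
        ≡⟨ collect a unit quotient M t ⟩
      unit * a + (a * quotient + t) * (unit * M)
        ∎

  isolate : ∀ {a a'} cs cs' → a < M → a' < M →
            a * G + combination cs rest ≡ a' * G + combination cs' rest →
            a ≡ a' × combination cs rest ≡ combination cs' rest
  isolate {a} {a'} cs cs' a<M a'<M eq =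
    a≡a' , +-cancelˡ-≡ (a * G) _ _ (trans eq (cong (λ x → x * G + combination cs' rest) (sym a≡a')))
    where
    a≡a' : a ≡ a'
    a≡a' = *-cancelˡ-≡ a a' unit (begin
      unit * a                                                ≡⟨ residue cs a<M ⟨
      (scale * (a * G + combination cs rest)) % (unit * M)    ≡⟨ cong (λ x → scale * x % (unit * M)) eq ⟩
      (scale * (a' * G + combination cs' rest)) % (unit * M)  ≡⟨ residue cs' a'<M ⟩
      unit * a'                                               ∎)

triangleRelations : Order → (A B C α β γ δ D : ℕ) → List (ℕ⁴ × ℕ⁴)
triangleRelations o A B C α β γ δ D =
    (vec o A 0 0 0 , vec o 0 α β 0)
  ∷ (vec o 0 B 0 0 , vec o 0 0 γ δ)
  ∷ (vec o 0 0 C 0 , vec o 0 0 0 D)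
  ∷ []

≡-transport : ∀ {x x' y y' : ℕ} → x ≡ x' → y ≡ y' → (x ≡ y ⇔ x' ≡ y')
≡-transport refl refl = mk⇔ (λ eq → eq) (λ eq → eq)

module TriangularRelations (o : Order) (A B C α β γ δ D : ℕ) where

  ρ : PairSet
  ρ = setOf (triangleRelations o A B C α β γ δ D)

  ψ : ℕ → ℕ → ℕ → ℕ → ℕ⁴ → ℕ
  ψ w₁ w₂ w₃ w₄ u = dot u (vec o w₁ w₂ w₃ w₄)

  module _ (w₁ w₂ w₃ w₄ : ℕ) where

    ψ-vec : ∀ a b c d →
            ψ w₁ w₂ w₃ w₄ (vec o a b c d) ≡ combination (a ∷ b ∷ c ∷ d ∷ []) (w₁ ∷ w₂ ∷ w₃ ∷ w₄ ∷ [])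
    ψ-vec a b c d = dot-vec o a b c d w₁ w₂ w₃ w₄

    respects-first : ψ w₁ w₂ w₃ w₄ (vec o A 0 0 0) ≡ ψ w₁ w₂ w₃ w₄ (vec o 0 α β 0) ⇔
                     A * w₁ ≡ α * w₂ + β * w₃
    respects-first = ≡-transport
      (trans (ψ-vec A 0 0 0) (+-identityʳ (A * w₁)))
      (trans (ψ-vec 0 α β 0) (cong (α * w₂ +_) (+-identityʳ (β * w₃))))

    respects-second : ψ w₁ w₂ w₃ w₄ (vec o 0 B 0 0) ≡ ψ w₁ w₂ w₃ w₄ (vec o 0 0 γ δ) ⇔
                      B * w₂ ≡ γ * w₃ + δ * w₄
    respects-second = ≡-transport
      (trans (ψ-vec 0 B 0 0) (+-identityʳ (B * w₂)))
      (trans (ψ-vec 0 0 γ δ) (cong (γ * w₃ +_) (+-identityʳ (δ * w₄))))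

    respects-third : ψ w₁ w₂ w₃ w₄ (vec o 0 0 C 0) ≡ ψ w₁ w₂ w₃ w₄ (vec o 0 0 0 D) ⇔
                     C * w₃ ≡ D * w₄
    respects-third = ≡-transport
      (trans (ψ-vec 0 0 C 0) (+-identityʳ (C * w₃)))
      (trans (ψ-vec 0 0 0 D) (+-identityʳ (D * w₄)))

    respects : A * w₁ ≡ α * w₂ + β * w₃ → B * w₂ ≡ γ * w₃ + δ * w₄ → C * w₃ ≡ D * w₄ →
               ∀ {p q} → ρ (p , q) → ψ w₁ w₂ w₃ w₄ p ≡ ψ w₁ w₂ w₃ w₄ q
    respects first _ _ (here refl)                 = Equivalence.from respects-first first
    respects _ second _ (there (here refl))        = Equivalence.from respects-second second
    respects _ _ third (there (there (here refl))) = Equivalence.from respects-third third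

  module _ {{_ : NonZero A}} {{_ : NonZero B}} {{_ : NonZero C}} where

    private
      coefficients : List ℕ
      coefficients = A ∷ B ∷ C ∷ α ∷ β ∷ γ ∷ δ ∷ D ∷ []

      instance
        A*B≢0 : NonZero (A * B)
        A*B≢0 = m*n≢0 A B

    separator : ∀ {p} → ρ p → Separator ρ p
    separator (here refl) = record
      { functional      = ψ 1 0 0 0
      ; additive        = dot-additive _
      ; separates       = λ eq → ≢-nonZero⁻¹ A (begin
          A              ≡⟨ solve coefficients ⟩
          A * 1          ≡⟨ Equivalence.to (respects-first 1 0 0 0) eq ⟩
          α * 0 + β * 0  ≡⟨ solve coefficients ⟩
          0              ∎)
      ; respects-others = λ where
          (here refl)                 → inj₁ refl
          (there (here refl))         →
            inj₂ (Equivalence.from (respects-second 1 0 0 0) (solve coefficients))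
          (there (there (here refl))) →
            inj₂ (Equivalence.from (respects-third 1 0 0 0) (solve coefficients))
      }
    separator (there (here refl)) = record
      { functional      = ψ α A 0 0
      ; additive        = dot-additive _
      ; separates       = λ eq → ≢-nonZero⁻¹ (B * A) {{m*n≢0 B A}} (begin
          B * A          ≡⟨ Equivalence.to (respects-second α A 0 0) eq ⟩
          γ * 0 + δ * 0  ≡⟨ solve coefficients ⟩
          0              ∎)
      ; respects-others = λ where
          (here refl)                 →
            inj₂ (Equivalence.from (respects-first α A 0 0) (solve coefficients))
          (there (here refl))         → inj₁ refl
          (there (there (here refl))) →
            inj₂ (Equivalence.from (respects-third α A 0 0) (solve coefficients))
      }
    separator (there (there (here refl))) = record
      { functional      = ψ (α * γ + β * B) (γ * A) (A * B) 0
      ; additive        = dot-additive _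
      ; separates       = λ eq → ≢-nonZero⁻¹ (C * (A * B)) {{m*n≢0 C (A * B)}} (begin
          C * (A * B)    ≡⟨ Equivalence.to (respects-third (α * γ + β * B) (γ * A) (A * B) 0) eq ⟩
          D * 0          ≡⟨ solve coefficients ⟩
          0              ∎)
      ; respects-others = λ where
          (here refl)                 → inj₂ (Equivalence.from
            (respects-first (α * γ + β * B) (γ * A) (A * B) 0) (solve coefficients))
          (there (here refl))         → inj₂ (Equivalence.from
            (respects-second (α * γ + β * B) (γ * A) (A * B) 0) (solve coefficients))
          (there (there (here refl))) → inj₁ refl
      }

record Triangle (n : ℕ) : Set where
  field
    order           : Order
    A B C α β γ δ D : ℕ
    {{A≢0}}         : NonZero A
    {{B≢0}}         : NonZero B
    {{C≢0}}         : NonZero C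
    Ga Gb Gc Gd     : ℕ
    {{Gd≢0}}        : NonZero Gd
    weights         : TH-weights n ≡ vec order Ga Gb Gc Gd
    relationA       : A * Ga ≡ α * Gb + β * Gc
    relationB       : B * Gb ≡ γ * Gc + δ * Gd
    relationC       : C * Gc ≡ D * Gd
    isolationA      : Isolation A Ga (Gb ∷ Gc ∷ Gd ∷ [])
    isolationB      : Isolation B Gb (Gc ∷ Gd ∷ [])
    isolationC      : Isolation C Gc [ Gd ]

  relations : List (ℕ⁴ × ℕ⁴)
  relations = triangleRelations order A B C α β γ δ D

module TriangleTheory {n : ℕ} (T : Triangle n) where
  open Triangle T
  open TriangularRelations order A B C α β γ δ D

  φ≡ψ : ∀ u → φ n u ≡ ψ Ga Gb Gc Gd u
  φ≡ψ u = trans (φ≡dot n u) (cong (dot u) weights)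

  φ-vec : ∀ a b c d →
          φ n (vec order a b c d) ≡ combination (a ∷ b ∷ c ∷ d ∷ []) (Ga ∷ Gb ∷ Gc ∷ Gd ∷ [])
  φ-vec a b c d = trans (φ≡ψ (vec order a b c d)) (ψ-vec Ga Gb Gc Gd a b c d)

  relations-hold : ∀ {p q} → ρ (p , q) → p ∼[ n ] q
  relations-hold {p} {q} ρpq =
    trans (φ≡ψ p) (trans (respects Ga Gb Gc Gd relationA relationB relationC ρpq) (sym (φ≡ψ q)))

  data Reduced : ℕ⁴ → Set where
    reduced : ∀ {a b c d} → a < A → b < B → c < C → Reduced (vec order a b c d)

  reduced-unique : ∀ {u v} → Reduced u → Reduced v → u ∼[ n ] v → u ≡ v
  reduced-unique (reduced {a} {b} {c} {d} a<A b<B c<C) (reduced {a'} {b'} {c'} {d'} a'<A b'<B c'<C)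
                 φu≡φv = vec-cong order (proj₁ level₁) (proj₁ level₂) (proj₁ level₃) d≡d'
    where
    level₁ : a ≡ a' × combination (b ∷ c ∷ d ∷ []) (Gb ∷ Gc ∷ Gd ∷ [])
                    ≡ combination (b' ∷ c' ∷ d' ∷ []) (Gb ∷ Gc ∷ Gd ∷ [])
    level₁ = isolate isolationA (b ∷ c ∷ d ∷ []) (b' ∷ c' ∷ d' ∷ []) a<A a'<A
      (trans (sym (φ-vec a b c d)) (trans φu≡φv (φ-vec a' b' c' d')))
    level₂ : b ≡ b' × combination (c ∷ d ∷ []) (Gc ∷ Gd ∷ [])
                    ≡ combination (c' ∷ d' ∷ []) (Gc ∷ Gd ∷ [])
    level₂ = isolate isolationB (c ∷ d ∷ []) (c' ∷ d' ∷ []) b<B b'<B (proj₂ level₁)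
    level₃ : c ≡ c' × combination [ d ] [ Gd ] ≡ combination [ d' ] [ Gd ]
    level₃ = isolate isolationC [ d ] [ d' ] c<C c'<C (proj₂ level₂)
    d≡d' : d ≡ d'
    d≡d' = *-cancelʳ-≡ d d' Gd
      (trans (sym (+-identityʳ (d * Gd))) (trans (proj₂ level₃) (+-identityʳ (d' * Gd))))

  module NormalForm (a b c d : ℕ) where
    b₁ c₁ c₂ d₂ : ℕ
    b₁ = a / A * α + b
    c₁ = a / A * β + c
    c₂ = b₁ / B * γ + c₁
    d₂ = b₁ / B * δ + d

    normalForm : ℕ⁴
    normalForm = vec order (a % A) (b₁ % B) (c₂ % C) (c₂ / C * D + d₂)

    normalForm-reduced : Reduced normalForm
    normalForm-reduced = reduced (m%n<n a A) (m%n<n b₁ B) (m%n<n c₂ C)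

    reduce : ∀ {R} → IsCongruence R → (∀ {p q} → ρ (p , q) → R p q) →
             R (vec order a b c d) normalForm
    reduce R-congruence ρ⊆R =
      R-trans (reduce-first order (ρ⊆R (here refl)) a b c d)
     (R-trans (reduce-second order (ρ⊆R (there (here refl))) (a % A) b₁ c₁ d)
              (reduce-third order (ρ⊆R (there (there (here refl)))) (a % A) (b₁ % B) c₂ d₂))
      where
      open Rewriting R-congruence
      open IsEquivalence (IsCongruence.isEquivalence R-congruence)
        using () renaming (trans to R-trans)

  open NormalForm

  generated : ∀ {u v} → u ∼[ n ] v → Generated ρ u v
  generated {u} {v} φu≡φv R R-congruence ρ⊆R with coordinatesOf order u | coordinatesOf order v
  ... | coordinates a b c d | coordinates a' b' c' d' =
    R-trans (reduce a b c d R-congruence ρ⊆R)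
      (subst (λ w → R w (vec order a' b' c' d')) (sym same-normal-form)
             (R-sym (reduce a' b' c' d' R-congruence ρ⊆R)))
    where
    open IsEquivalence (IsCongruence.isEquivalence R-congruence)
      using () renaming (sym to R-sym; trans to R-trans)
    reduce-φ : ∀ a b c d → vec order a b c d ∼[ n ] normalForm a b c d
    reduce-φ a b c d = reduce a b c d (kernel-isCongruence (φ-additive n)) relations-hold
    same-normal-form : normalForm a b c d ≡ normalForm a' b' c' d'
    same-normal-form = reduced-unique (normalForm-reduced a b c d) (normalForm-reduced a' b' c' d')
      (trans (sym (reduce-φ a b c d)) (trans φu≡φv (reduce-φ a' b' c' d')))

  presentation : IsPresentation n ρ
  presentation u v = mk⇔ (λ gen → lift (generated⊆kernel (φ-additive n) relations-hold gen))
                         (λ φu≡φv → generated (lower φu≡φv))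

  minimal : IsMinimalPresentation n ρ
  minimal = minimal-if-separated presentation separator

triangle-minimal : ∀ {n} (T : Triangle n) → IsMinimalPresentation n (setOf (Triangle.relations T))
triangle-minimal = TriangleTheory.minimal

-- The paper's notation, in which a relation with a vanishing coefficient has one term less.

relations-without-δ : ∀ o {A B C α β γ D A' B' C' α' β' γ' D'} →
  A ≡ A' → B ≡ B' → C ≡ C' → α ≡ α' → β ≡ β' → γ ≡ γ' → D ≡ D' →
  setOf ((A · e₁ o , α · e₂ o ⊕ β · e₃ o) ∷ (B · e₂ o , γ · e₃ o) ∷ (C · e₃ o , D · e₄ o) ∷ [])
    ≡ setOf (triangleRelations o A' B' C' α' β' γ' 0 D')
relations-without-δ o {A} {B} {C} {α} {β} {γ} {D} refl refl refl refl refl refl refl = cong setOf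
  (cong₂ _∷_ (cong₂ _,_ (·-e₁ o A) (·-e₂⊕·-e₃ o α β))
  (cong₂ _∷_ (cong₂ _,_ (·-e₂ o B) (·-e₃ o γ))
  (cong₂ _∷_ (cong₂ _,_ (·-e₃ o C) (·-e₄ o D)) refl)))

relations-without-β : ∀ o {A B C α γ δ D A' B' C' α' γ' δ' D'} →
  A ≡ A' → B ≡ B' → C ≡ C' → α ≡ α' → γ ≡ γ' → δ ≡ δ' → D ≡ D' →
  setOf ((A · e₁ o , α · e₂ o) ∷ (B · e₂ o , γ · e₃ o ⊕ δ · e₄ o) ∷ (C · e₃ o , D · e₄ o) ∷ [])
    ≡ setOf (triangleRelations o A' B' C' α' 0 γ' δ' D')
relations-without-β o {A} {B} {C} {α} {γ} {δ} {D} refl refl refl refl refl refl refl = cong setOf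
  (cong₂ _∷_ (cong₂ _,_ (·-e₁ o A) (·-e₂ o α))
  (cong₂ _∷_ (cong₂ _,_ (·-e₂ o B) (·-e₃⊕·-e₄ o γ δ))
  (cong₂ _∷_ (cong₂ _,_ (·-e₃ o C) (·-e₄ o D)) refl)))

exact-quotient : ∀ m d {q} .{{_ : NonZero d}} → m ≡ q * d → m / d ≡ q
exact-quotient _ d {q} refl = m*n/n≡m q d

-- The six residues of n modulo 6

triangle₀ : ∀ j → Triangle (6 * suc j)
triangle₀ j = record
  { order = descending
  ; A = 4 + 3 * j ; B = 7 + 6 * j ; C = 2 + 2 * j
  ; α = 2 ; β = 5 + 3 * j ; γ = 10 + 6 * j ; δ = 0 ; D = 3 + 2 * j
  ; Ga = 165 + 299 * j + 180 * j * j + 36 * j * j * j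
  ; Gb = 120 + 242 * j + 162 * j * j + 36 * j * j * j
  ; Gc = 84 + 191 * j + 144 * j * j + 36 * j * j * j
  ; Gd = 56 + 146 * j + 126 * j * j + 36 * j * j * j
  ; weights = vec-cong descending
      (TH-closed-form (6 * suc j + 3) (solve [ j ])) (TH-closed-form (6 * suc j + 2) (solve [ j ]))
      (TH-closed-form (6 * suc j + 1) (solve [ j ])) (TH-closed-form (6 * suc j) (solve [ j ]))
  ; relationA = solve [ j ]
  ; relationB = solve [ j ]
  ; relationC = solve [ j ]
  ; isolationA = record
      { scale = 1 ; unit = 1 ; quotient = 41 + 44 * j + 12 * j * j
      ; leading = solve [ j ]
      ; annihilates = divides (30 + 38 * j + 12 * j * j) (solve [ j ])
                    ∷ divides (21 + 32 * j + 12 * j * j) (solve [ j ])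
                    ∷ divides (14 + 26 * j + 12 * j * j) (solve [ j ])
                    ∷ [] }
  ; isolationB = record
      { scale = 4 + 3 * j ; unit = 4 + 3 * j ; quotient = 17 + 20 * j + 6 * j * j
      ; leading = solve [ j ]
      ; annihilates = divides (12 + 17 * j + 6 * j * j) (solve [ j ])
                    ∷ divides (8 + 14 * j + 6 * j * j) (solve [ j ])
                    ∷ [] }
  ; isolationC = record
      { scale = 1 ; unit = 28 + 45 * j + 18 * j * j ; quotient = 1
      ; leading = solve [ j ]
      ; annihilates = divides 1 (solve [ j ])
                    ∷ [] }
  }

ρ₀-minimal : ∀ k → 4 ≤ 6 * k → IsMinimalPresentation (6 * k) (ρ₀ (6 * k))
ρ₀-minimal zero    ()
ρ₀-minimal (suc j) _ =
  subst (IsMinimalPresentation (6 * suc j)) (sym ρ₀≡) (triangle-minimal (triangle₀ j))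
  where
  ρ₀≡ : ρ₀ (6 * suc j) ≡ setOf (Triangle.relations (triangle₀ j))
  ρ₀≡ = relations-without-δ descending A≡ B≡ C≡ refl β≡ γ≡ D≡
    where
    A≡ : (6 * suc j + 2) / 2 ≡ 4 + 3 * j
    A≡ = exact-quotient (6 * suc j + 2) 2 (solve [ j ])
    B≡ : 6 * suc j + 1 ≡ 7 + 6 * j
    B≡ = solve [ j ]
    C≡ : 6 * suc j / 3 ≡ 2 + 2 * j
    C≡ = exact-quotient (6 * suc j) 3 (solve [ j ])
    β≡ : (6 * suc j + 4) / 2 ≡ 5 + 3 * j
    β≡ = exact-quotient (6 * suc j + 4) 2 (solve [ j ])
    γ≡ : 6 * suc j + 4 ≡ 10 + 6 * j
    γ≡ = solve [ j ]
    D≡ : (6 * suc j + 3) / 3 ≡ 3 + 2 * j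
    D≡ = exact-quotient (6 * suc j + 3) 3 (solve [ j ])

triangle₁ : ∀ k → Triangle (6 * k + 1)
triangle₁ k = record
  { order = descending
  ; A = 1 + 2 * k ; B = 1 + 3 * k ; C = 1 + 6 * k
  ; α = 2 + 2 * k ; β = 0 ; γ = 2 ; δ = 2 + 3 * k ; D = 4 + 6 * k
  ; Ga = 20 + 74 * k + 90 * k * k + 36 * k * k * k
  ; Gb = 10 + 47 * k + 72 * k * k + 36 * k * k * k
  ; Gc = 4 + 26 * k + 54 * k * k + 36 * k * k * k
  ; Gd = 1 + 11 * k + 36 * k * k + 36 * k * k * k
  ; weights = vec-cong descending
      (TH-closed-form (6 * k + 1 + 3) (solve [ k ])) (TH-closed-form (6 * k + 1 + 2) (solve [ k ]))
      (TH-closed-form (6 * k + 1 + 1) (solve [ k ])) (TH-closed-form (6 * k + 1) (solve [ k ]))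
  ; relationA = solve [ k ]
  ; relationB = solve [ k ]
  ; relationC = solve [ k ]
  ; isolationA = record
      { scale = 1 ; unit = 1 ; quotient = 19 + 36 * k + 18 * k * k
      ; leading = solve [ k ]
      ; annihilates = divides (10 + 27 * k + 18 * k * k) (solve [ k ])
                    ∷ divides (4 + 18 * k + 18 * k * k) (solve [ k ])
                    ∷ divides (1 + 9 * k + 18 * k * k) (solve [ k ])
                    ∷ [] }
  ; isolationB = record
      { scale = 1 + 2 * k ; unit = 1 + 2 * k ; quotient = 9 + 20 * k + 12 * k * k
      ; leading = solve [ k ]
      ; annihilates = divides (4 + 14 * k + 12 * k * k) (solve [ k ])
                    ∷ divides (1 + 8 * k + 12 * k * k) (solve [ k ])
                    ∷ [] }
  ; isolationC = record
      { scale = 1 + 4 * k ; unit = 1 + 5 * k + 6 * k * k ; quotient = 3 + 4 * k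
      ; leading = solve [ k ]
      ; annihilates = divides (1 + 4 * k) (solve [ k ])
                    ∷ [] }
  }

ρ₁-minimal : ∀ k → IsMinimalPresentation (6 * k + 1) (ρ₁ (6 * k + 1))
ρ₁-minimal k =
  subst (IsMinimalPresentation (6 * k + 1)) (sym ρ₁≡) (triangle-minimal (triangle₁ k))
  where
  ρ₁≡ : ρ₁ (6 * k + 1) ≡ setOf (Triangle.relations (triangle₁ k))
  ρ₁≡ = relations-without-β descending A≡ B≡ C≡ α≡ refl δ≡ D≡
    where
    A≡ : (6 * k + 1 + 2) / 3 ≡ 1 + 2 * k
    A≡ = exact-quotient (6 * k + 1 + 2) 3 (solve [ k ])
    B≡ : (6 * k + 1 + 1) / 2 ≡ 1 + 3 * k
    B≡ = exact-quotient (6 * k + 1 + 1) 2 (solve [ k ])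
    C≡ : 6 * k + 1 ≡ 1 + 6 * k
    C≡ = solve [ k ]
    α≡ : (6 * k + 1 + 5) / 3 ≡ 2 + 2 * k
    α≡ = exact-quotient (6 * k + 1 + 5) 3 (solve [ k ])
    δ≡ : (6 * k + 1 + 3) / 2 ≡ 2 + 3 * k
    δ≡ = exact-quotient (6 * k + 1 + 3) 2 (solve [ k ])
    D≡ : 6 * k + 1 + 3 ≡ 4 + 6 * k
    D≡ = solve [ k ]

triangle₂ : ∀ k → Triangle (6 * k + 2)
triangle₂ k = record
  { order = descending
  ; A = 2 + 3 * k ; B = 1 + 2 * k ; C = 2 + 6 * k
  ; α = 2 ; β = 3 + 3 * k ; γ = 2 + 2 * k ; δ = 0 ; D = 5 + 6 * k
  ; Ga = 35 + 107 * k + 108 * k * k + 36 * k * k * k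
  ; Gb = 20 + 74 * k + 90 * k * k + 36 * k * k * k
  ; Gc = 10 + 47 * k + 72 * k * k + 36 * k * k * k
  ; Gd = 4 + 26 * k + 54 * k * k + 36 * k * k * k
  ; weights = vec-cong descending
      (TH-closed-form (6 * k + 2 + 3) (solve [ k ])) (TH-closed-form (6 * k + 2 + 2) (solve [ k ]))
      (TH-closed-form (6 * k + 2 + 1) (solve [ k ])) (TH-closed-form (6 * k + 2) (solve [ k ]))
  ; relationA = solve [ k ]
  ; relationB = solve [ k ]
  ; relationC = solve [ k ]
  ; isolationA = record
      { scale = 1 ; unit = 1 ; quotient = 17 + 28 * k + 12 * k * k
      ; leading = solve [ k ]
      ; annihilates = divides (10 + 22 * k + 12 * k * k) (solve [ k ])
                    ∷ divides (5 + 16 * k + 12 * k * k) (solve [ k ])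
                    ∷ divides (2 + 10 * k + 12 * k * k) (solve [ k ])
                    ∷ [] }
  ; isolationB = record
      { scale = 1 + k ; unit = 2 + 3 * k ; quotient = 9 + 14 * k + 6 * k * k
      ; leading = solve [ k ]
      ; annihilates = divides (5 + 11 * k + 6 * k * k) (solve [ k ])
                    ∷ divides (2 + 8 * k + 6 * k * k) (solve [ k ])
                    ∷ [] }
  ; isolationC = record
      { scale = 1 + 2 * k ; unit = 2 + 7 * k + 6 * k * k ; quotient = 2 + 2 * k
      ; leading = solve [ k ]
      ; annihilates = divides (1 + 2 * k) (solve [ k ])
                    ∷ [] }
  }

ρ₂-minimal : ∀ k → IsMinimalPresentation (6 * k + 2) (ρ₂ (6 * k + 2))
ρ₂-minimal k =
  subst (IsMinimalPresentation (6 * k + 2)) (sym ρ₂≡) (triangle-minimal (triangle₂ k))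
  where
  ρ₂≡ : ρ₂ (6 * k + 2) ≡ setOf (Triangle.relations (triangle₂ k))
  ρ₂≡ = relations-without-δ descending A≡ B≡ C≡ refl β≡ γ≡ D≡
    where
    A≡ : (6 * k + 2 + 2) / 2 ≡ 2 + 3 * k
    A≡ = exact-quotient (6 * k + 2 + 2) 2 (solve [ k ])
    B≡ : (6 * k + 2 + 1) / 3 ≡ 1 + 2 * k
    B≡ = exact-quotient (6 * k + 2 + 1) 3 (solve [ k ])
    C≡ : 6 * k + 2 ≡ 2 + 6 * k
    C≡ = solve [ k ]
    β≡ : (6 * k + 2 + 4) / 2 ≡ 3 + 3 * k
    β≡ = exact-quotient (6 * k + 2 + 4) 2 (solve [ k ])
    γ≡ : (6 * k + 2 + 4) / 3 ≡ 2 + 2 * k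
    γ≡ = exact-quotient (6 * k + 2 + 4) 3 (solve [ k ])
    D≡ : 6 * k + 2 + 3 ≡ 5 + 6 * k
    D≡ = solve [ k ]

triangle₃ : ∀ k → Triangle (6 * k + 3)
triangle₃ k = record
  { order = descending
  ; A = 5 + 6 * k ; B = 2 + 3 * k ; C = 1 + 2 * k
  ; α = 8 + 6 * k ; β = 0 ; γ = 2 ; δ = 3 + 3 * k ; D = 2 + 2 * k
  ; Ga = 56 + 146 * k + 126 * k * k + 36 * k * k * k
  ; Gb = 35 + 107 * k + 108 * k * k + 36 * k * k * k
  ; Gc = 20 + 74 * k + 90 * k * k + 36 * k * k * k
  ; Gd = 10 + 47 * k + 72 * k * k + 36 * k * k * k
  ; weights = vec-cong descending
      (TH-closed-form (6 * k + 3 + 3) (solve [ k ])) (TH-closed-form (6 * k + 3 + 2) (solve [ k ]))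
      (TH-closed-form (6 * k + 3 + 1) (solve [ k ])) (TH-closed-form (6 * k + 3) (solve [ k ]))
  ; relationA = solve [ k ]
  ; relationB = solve [ k ]
  ; relationC = solve [ k ]
  ; isolationA = record
      { scale = 1 ; unit = 1 ; quotient = 11 + 16 * k + 6 * k * k
      ; leading = solve [ k ]
      ; annihilates = divides (7 + 13 * k + 6 * k * k) (solve [ k ])
                    ∷ divides (4 + 10 * k + 6 * k * k) (solve [ k ])
                    ∷ divides (2 + 7 * k + 6 * k * k) (solve [ k ])
                    ∷ [] }
  ; isolationB = record
      { scale = 1 ; unit = 5 + 6 * k ; quotient = 3 + 2 * k
      ; leading = solve [ k ]
      ; annihilates = divides (2 + 2 * k) (solve [ k ])
                    ∷ divides (1 + 2 * k) (solve [ k ])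
                    ∷ [] }
  ; isolationC = record
      { scale = 1 ; unit = 10 + 27 * k + 18 * k * k ; quotient = 1
      ; leading = solve [ k ]
      ; annihilates = divides 1 (solve [ k ])
                    ∷ [] }
  }

ρ₃-minimal : ∀ k → IsMinimalPresentation (6 * k + 3) (ρ₃ (6 * k + 3))
ρ₃-minimal k =
  subst (IsMinimalPresentation (6 * k + 3)) (sym ρ₃≡) (triangle-minimal (triangle₃ k))
  where
  ρ₃≡ : ρ₃ (6 * k + 3) ≡ setOf (Triangle.relations (triangle₃ k))
  ρ₃≡ = relations-without-β descending A≡ B≡ C≡ α≡ refl δ≡ D≡
    where
    A≡ : 6 * k + 3 + 2 ≡ 5 + 6 * k
    A≡ = solve [ k ]
    B≡ : (6 * k + 3 + 1) / 2 ≡ 2 + 3 * k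
    B≡ = exact-quotient (6 * k + 3 + 1) 2 (solve [ k ])
    C≡ : (6 * k + 3) / 3 ≡ 1 + 2 * k
    C≡ = exact-quotient (6 * k + 3) 3 (solve [ k ])
    α≡ : 6 * k + 3 + 5 ≡ 8 + 6 * k
    α≡ = solve [ k ]
    δ≡ : (6 * k + 3 + 3) / 2 ≡ 3 + 3 * k
    δ≡ = exact-quotient (6 * k + 3 + 3) 2 (solve [ k ])
    D≡ : (6 * k + 3 + 3) / 3 ≡ 2 + 2 * k
    D≡ = exact-quotient (6 * k + 3 + 3) 3 (solve [ k ])

triangle₄ : ∀ k → Triangle (6 * k + 4)
triangle₄ k = record
  { order = ascending
  ; A = 7 + 6 * k ; B = 4 + 3 * k ; C = 3 + 2 * k
  ; α = 4 + 6 * k ; β = 0 ; γ = 1 + 2 * k ; δ = 1 + k ; D = 2 + 2 * k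
  ; Ga = 20 + 74 * k + 90 * k * k + 36 * k * k * k
  ; Gb = 35 + 107 * k + 108 * k * k + 36 * k * k * k
  ; Gc = 56 + 146 * k + 126 * k * k + 36 * k * k * k
  ; Gd = 84 + 191 * k + 144 * k * k + 36 * k * k * k
  ; weights = vec-cong ascending
      (TH-closed-form (6 * k + 4) (solve [ k ])) (TH-closed-form (6 * k + 4 + 1) (solve [ k ]))
      (TH-closed-form (6 * k + 4 + 2) (solve [ k ])) (TH-closed-form (6 * k + 4 + 3) (solve [ k ]))
  ; relationA = solve [ k ]
  ; relationB = solve [ k ]
  ; relationC = solve [ k ]
  ; isolationA = record
      { scale = 6 + 6 * k ; unit = 1 ; quotient = 17 + 66 * k + 84 * k * k + 36 * k * k * k
      ; leading = solve [ k ]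
      ; annihilates = divides (30 + 96 * k + 102 * k * k + 36 * k * k * k) (solve [ k ])
                    ∷ divides (48 + 132 * k + 120 * k * k + 36 * k * k * k) (solve [ k ])
                    ∷ divides (72 + 174 * k + 138 * k * k + 36 * k * k * k) (solve [ k ])
                    ∷ [] }
  ; isolationB = record
      { scale = 1 ; unit = 7 + 6 * k ; quotient = 1 + 2 * k
      ; leading = solve [ k ]
      ; annihilates = divides (2 + 2 * k) (solve [ k ])
                    ∷ divides (3 + 2 * k) (solve [ k ])
                    ∷ [] }
  ; isolationC = record
      { scale = 2 + 2 * k ; unit = 28 + 45 * k + 18 * k * k ; quotient = 1 + 2 * k
      ; leading = solve [ k ]
      ; annihilates = divides (2 + 2 * k) (solve [ k ])
                    ∷ [] }
  }

ρ₄-minimal : ∀ k → IsMinimalPresentation (6 * k + 4) (ρ₄ (6 * k + 4))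
ρ₄-minimal k =
  subst (IsMinimalPresentation (6 * k + 4)) (sym ρ₄≡) (triangle-minimal (triangle₄ k))
  where
  ρ₄≡ : ρ₄ (6 * k + 4) ≡ setOf (Triangle.relations (triangle₄ k))
  ρ₄≡ = relations-without-β ascending A≡ B≡ C≡ α≡ γ≡ δ≡ D≡
    where
    A≡ : 6 * k + 4 + 3 ≡ 7 + 6 * k
    A≡ = solve [ k ]
    B≡ : (6 * k + 4 + 4) / 2 ≡ 4 + 3 * k
    B≡ = exact-quotient (6 * k + 4 + 4) 2 (solve [ k ])
    C≡ : (6 * k + 4 + 5) / 3 ≡ 3 + 2 * k
    C≡ = exact-quotient (6 * k + 4 + 5) 3 (solve [ k ])
    α≡ : 6 * k + 4 ≡ 4 + 6 * k
    α≡ = solve [ k ]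
    γ≡ : (6 * k + 4 ∸ 1) / 3 ≡ 1 + 2 * k
    γ≡ = exact-quotient (6 * k + 4 ∸ 1) 3 (trans (+-∸-assoc (6 * k) (s≤s z≤n)) (solve [ k ]))
    δ≡ : (6 * k + 4 + 2) / 6 ≡ 1 + k
    δ≡ = exact-quotient (6 * k + 4 + 2) 6 (solve [ k ])
    D≡ : (6 * k + 4 + 2) / 3 ≡ 2 + 2 * k
    D≡ = exact-quotient (6 * k + 4 + 2) 3 (solve [ k ])

triangle₅ : ∀ k → Triangle (6 * k + 5)
triangle₅ k = record
  { order = ascending
  ; A = 4 + 3 * k ; B = 3 + 2 * k ; C = 10 + 6 * k
  ; α = 1 + 2 * k ; β = 1 + k ; γ = 2 + 2 * k ; δ = 0 ; D = 7 + 6 * k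
  ; Ga = 35 + 107 * k + 108 * k * k + 36 * k * k * k
  ; Gb = 56 + 146 * k + 126 * k * k + 36 * k * k * k
  ; Gc = 84 + 191 * k + 144 * k * k + 36 * k * k * k
  ; Gd = 120 + 242 * k + 162 * k * k + 36 * k * k * k
  ; weights = vec-cong ascending
      (TH-closed-form (6 * k + 5) (solve [ k ])) (TH-closed-form (6 * k + 5 + 1) (solve [ k ]))
      (TH-closed-form (6 * k + 5 + 2) (solve [ k ])) (TH-closed-form (6 * k + 5 + 3) (solve [ k ]))
  ; relationA = solve [ k ]
  ; relationB = solve [ k ]
  ; relationC = solve [ k ]
  ; isolationA = record
      { scale = 3 + 3 * k ; unit = 1 ; quotient = 26 + 87 * k + 96 * k * k + 36 * k * k * k
      ; leading = solve [ k ]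
      ; annihilates = divides (42 + 120 * k + 114 * k * k + 36 * k * k * k) (solve [ k ])
                    ∷ divides (63 + 159 * k + 132 * k * k + 36 * k * k * k) (solve [ k ])
                    ∷ divides (90 + 204 * k + 150 * k * k + 36 * k * k * k) (solve [ k ])
                    ∷ [] }
  ; isolationB = record
      { scale = 2 + k ; unit = 4 + 3 * k ; quotient = 9 + 16 * k + 6 * k * k
      ; leading = solve [ k ]
      ; annihilates = divides (14 + 19 * k + 6 * k * k) (solve [ k ])
                    ∷ divides (20 + 22 * k + 6 * k * k) (solve [ k ])
                    ∷ [] }
  ; isolationC = record
      { scale = 3 + 2 * k ; unit = 12 + 17 * k + 6 * k * k ; quotient = 2 + 2 * k
      ; leading = solve [ k ]
      ; annihilates = divides (3 + 2 * k) (solve [ k ])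
                    ∷ [] }
  }

ρ₅-minimal : ∀ k → IsMinimalPresentation (6 * k + 5) (ρ₅ (6 * k + 5))
ρ₅-minimal k =
  subst (IsMinimalPresentation (6 * k + 5)) (sym ρ₅≡) (triangle-minimal (triangle₅ k))
  where
  ρ₅≡ : ρ₅ (6 * k + 5) ≡ setOf (Triangle.relations (triangle₅ k))
  ρ₅≡ = relations-without-δ ascending A≡ B≡ C≡ α≡ β≡ γ≡ D≡
    where
    A≡ : (6 * k + 5 + 3) / 2 ≡ 4 + 3 * k
    A≡ = exact-quotient (6 * k + 5 + 3) 2 (solve [ k ])
    B≡ : (6 * k + 5 + 4) / 3 ≡ 3 + 2 * k
    B≡ = exact-quotient (6 * k + 5 + 4) 3 (solve [ k ])
    C≡ : 6 * k + 5 + 5 ≡ 10 + 6 * k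
    C≡ = solve [ k ]
    α≡ : (6 * k + 5 ∸ 2) / 3 ≡ 1 + 2 * k
    α≡ = exact-quotient (6 * k + 5 ∸ 2) 3 (trans (+-∸-assoc (6 * k) (s≤s (s≤s z≤n))) (solve [ k ]))
    β≡ : (6 * k + 5 + 1) / 6 ≡ 1 + k
    β≡ = exact-quotient (6 * k + 5 + 1) 6 (solve [ k ])
    γ≡ : (6 * k + 5 + 1) / 3 ≡ 2 + 2 * k
    γ≡ = exact-quotient (6 * k + 5 + 1) 3 (solve [ k ])
    D≡ : 6 * k + 5 + 2 ≡ 7 + 6 * k
    D≡ = solve [ k ]

proposition33 : (n k : ℕ) → 4 ≤ n →
    (n ≡ 6 * k → IsMinimalPresentation n (ρ₀ n)) ×
    (n ≡ 6 * k + 1 → IsMinimalPresentation n (ρ₁ n)) ×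
    (n ≡ 6 * k + 2 → IsMinimalPresentation n (ρ₂ n)) ×
    (n ≡ 6 * k + 3 → IsMinimalPresentation n (ρ₃ n)) ×
    (n ≡ 6 * k + 4 → IsMinimalPresentation n (ρ₄ n)) ×
    (n ≡ 6 * k + 5 → IsMinimalPresentation n (ρ₅ n))
proposition33 n k 4≤n =
    (λ { refl → ρ₀-minimal k 4≤n })
  , (λ { refl → ρ₁-minimal k })
  , (λ { refl → ρ₂-minimal k })
  , (λ { refl → ρ₃-minimal k })
  , (λ { refl → ρ₄-minimal k })
  , (λ { refl → ρ₅-minimal k })
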